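{- Let $\leq$ be a family of partial orders, one on $SYT_N$ for each $N\ge1$, such that (a) $\leq$ is stronger than the weak order, i.e. $S\leq_{weak}T$ implies $S\le T$, and (b) $\leq$ restricts to segments, i.e. $S\le T$ in $SYT_N$ implies $\mathrm{st}(S_{[i,j]})\le\mathrm{st}(T_{[i,j]})$ for all $1\le i<j\le N$. Then for every $n\ge2$ the map $(SYT_n,\leq)\to(2^{[n-1]},\subseteq)$, $T\mapsto\mathrm{Des}(T)$, is order-preserving.
   Context: $SYT_N$: standard Young tableaux with $N$ cells. $\mathrm{Des}(T)=\{i\in[N-1]: i+1$ appears in a row strictly below the row of $i\}$. For $T\in SYT_N$, $T_{[i,j]}$ is the skew subtableau of entries in $[i,j]$, and $\mathrm{st}(T_{[i,j]})$ is obtained by subtracting $i-1$ from entries and rectifying by jeu de taquin. For $w\in S_N$, $P(w)$ is its Robinson–Schensted insertion tableau, $C_T=\{w:P(w)=T\}$, $\mathrm{Inv}_L(w)=\{(i,j):i<j,\ w^{ -1}(i)>w^{ -1}(j)\}$; right weak order on $S_N$: $u\le w$ iff $\mathrm{Inv}_L(u)\subseteq\mathrm{Inv}_L(w)$. The weak order $\leq_{weak}$ on $SYT_N$ is the transitive closure of "$S\le T$ if $\sigma\le\tau$ in right weak order for some $\sigma\in C_S,\tau\in C_T$". -}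

module Defs where

open import Data.Nat using (ℕ; zero; suc; _+_; _*_; _∸_; _≤_; _<_; _<ᵇ_; _≡ᵇ_)
open import Data.Bool using (Bool; true; false; if_then_else_)
open import Data.Maybe using (Maybe; just; nothing)
open import Data.Product using (Σ; _×_; _,_; proj₁; proj₂; map₂)
open import Data.List using (List; []; _∷_; [_]; _++_; map; foldl; length; concat; reverse; upTo; catMaybes; filter; take)
open import Data.List.Membership.Propositional using (_∈_)
open import Data.List.Relation.Binary.Permutation.Propositional using (_↭_)
open import Data.List.Relation.Unary.All using (All)
open import Data.List.Relation.Unary.Linked using (Linked)
open import Relation.Binary.PropositionalEquality using (_≡_)
open import Relation.Binary.Construct.Closure.Transitive using (TransClosure)
open import Relation.Nullary using (¬_)

-- Tableaux: a (raw) tableau is the list of its rows, top row first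
-- (English convention); rows and columns are indexed from 0.

Tab : Set
Tab = List (List ℕ)

range : ℕ → List ℕ
range N = map suc (upTo N)

at : {A : Set} → List A → ℕ → Maybe A
at []       _       = nothing
at (x ∷ xs) zero    = just x
at (x ∷ xs) (suc k) = at xs k

cell : {A : Set} → List (List A) → ℕ → ℕ → Maybe A
cell T r c with at T r
... | nothing  = nothing
... | just row = at row c

record IsSYT (N : ℕ) (T : Tab) : Set where
  field
    rowsNonempty : All (λ row → 1 ≤ length row) T
    shapePartition : Linked (λ a b → b ≤ a) (map length T)
    rowsIncrease : All (Linked _<_) T
    colsIncrease : ∀ r c b → cell T (suc r) c ≡ just b →
                   Σ ℕ (λ a → cell T r c ≡ just a × a < b)
    content : concat T ↭ range N

InRow : Tab → ℕ → ℕ → Set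
InRow T r x = Σ (List ℕ) (λ row → at T r ≡ just row × x ∈ row)

Des : ℕ → Tab → ℕ → Set
Des N T i = 1 ≤ i × i < N ×
  Σ ℕ (λ r → Σ ℕ (λ r' → r < r' × InRow T r i × InRow T r' (suc i)))

bumpRow : ℕ → List ℕ → Maybe ℕ × List ℕ
bumpRow x []       = nothing , [ x ]
bumpRow x (y ∷ ys) = if x <ᵇ y then (just y , x ∷ ys) else map₂ (y ∷_) (bumpRow x ys)

insertT : ℕ → Tab → Tab
insertT x [] = [ [ x ] ]
insertT x (row ∷ rows) with bumpRow x row
... | nothing , row' = row' ∷ rows
... | just y  , row' = row' ∷ insertT y rows

-- insertion tableau of a word w = w(1) w(2) ... w(N) (one-line notation)
P : List ℕ → Tab
P w = foldl (λ t x → insertT x t) [] w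

IsPerm : ℕ → List ℕ → Set
IsPerm N w = w ↭ range N

Before : List ℕ → ℕ → ℕ → Set
Before w x y = Σ (List ℕ) λ xs → Σ (List ℕ) λ ys → Σ (List ℕ) λ zs →
  w ≡ xs ++ x ∷ ys ++ y ∷ zs

-- Inv_L(w) = {(i,j) : i < j, w⁻¹(i) > w⁻¹(j)}  (j occurs before i)
InvL : List ℕ → ℕ → ℕ → Set
InvL w i j = i < j × Before w j i

_≤R_ : List ℕ → List ℕ → Set
u ≤R w = ∀ i j → InvL u i j → InvL w i j

WeakStep : ℕ → Tab → Tab → Set
WeakStep N S T = Σ (List ℕ) λ σ → Σ (List ℕ) λ τ →
  IsPerm N σ × IsPerm N τ × P σ ≡ S × P τ ≡ T × σ ≤R τ

_≤weak[_]_ : Tab → ℕ → Tab → Set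
S ≤weak[ N ] T = TransClosure (WeakStep N) S T

-- Segments and jeu de taquin rectification.
-- A skew tableau is a list of rows of cells; 'nothing' marks an empty
-- (inner) cell.

STab : Set
STab = List (List (Maybe ℕ))

setAt : {A : Set} → List A → ℕ → A → List A
setAt []       _       _ = []
setAt (x ∷ xs) zero    y = y ∷ xs
setAt (x ∷ xs) (suc k) y = x ∷ setAt xs k y

modAt : {A : Set} → List A → ℕ → (A → A) → List A
modAt []       _       _ = []
modAt (x ∷ xs) zero    f = f x ∷ xs
modAt (x ∷ xs) (suc k) f = x ∷ modAt xs k f

setCell : {A : Set} → List (List A) → ℕ → ℕ → A → List (List A)
setCell T r c a = modAt T r (λ row → setAt row c a)

nonEmpty : {A : Set} → List A → Bool
nonEmpty []      = false
nonEmpty (_ ∷ _) = true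

dropEmptyRows : {A : Set} → List (List A) → List (List A)
dropEmptyRows []         = []
dropEmptyRows (row ∷ rs) with nonEmpty row
... | true  = row ∷ dropEmptyRows rs
... | false = dropEmptyRows rs

-- The fuel argument bounds the number of moves (an empty cell moves at
-- most (#rows + #columns) times, so fuel ≥ 2·#cells + 1 suffices).
slide : ℕ → ℕ → ℕ → STab → STab
slide zero r c t = t
slide (suc f) r c t with cell t r (suc c) | cell t (suc r) c
... | just (just a) | just (just b) =
  if a <ᵇ b
  then slide f r (suc c) (setCell (setCell t r c (just a)) r (suc c) nothing)
  else slide f (suc r) c (setCell (setCell t r c (just b)) (suc r) c nothing)
... | just (just a) | _ =
  slide f r (suc c) (setCell (setCell t r c (just a)) r (suc c) nothing)
... | _ | just (just b) =
  slide f (suc r) c (setCell (setCell t r c (just b)) (suc r) c nothing)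
... | _ | _ = dropEmptyRows (modAt t r (take c))

-- position (row , column) of entry x in T (junk (0 , 0) if absent)
posIn : ℕ → List ℕ → Maybe ℕ
posIn x []       = nothing
posIn x (y ∷ ys) = if x ≡ᵇ y then just 0 else Data.Maybe.map suc (posIn x ys)
  where import Data.Maybe

cellOf : ℕ → Tab → ℕ × ℕ
cellOf x []       = 0 , 0
cellOf x (row ∷ rs) with posIn x row
... | just c  = 0 , c
... | nothing = map₁' (cellOf x rs)
  where
  map₁' : ℕ × ℕ → ℕ × ℕ
  map₁' (r , c) = suc r , c

segment : ℕ → ℕ → Tab → STab
segment i j T = dropEmptyRows (map (λ row → catMaybes (map f row)) T)
  where
  f : ℕ → Maybe (Maybe ℕ)
  f x = if x <ᵇ i then just nothing
        else (if j <ᵇ x then nothing else just (just (x ∸ (i ∸ 1))))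

-- st(T_[i,j]): rectify T_[i,j] by jeu de taquin, sliding into the
-- empty cells in the order of decreasing entries of T
-- (i-1, i-2, ..., 1; each is an inner corner when its turn comes).
st : Tab → ℕ → ℕ → Tab
st T i j =
  dropEmptyRows (map catMaybes
    (foldl (λ t k → slide fuel (proj₁ (cellOf k T)) (proj₂ (cellOf k T)) t)
           (segment i j T) (reverse (range (i ∸ 1)))))
  where
  fuel = 2 * length (concat T) + 1

-- A family of partial orders, one on SYT_N for each N ≥ 1, given as a
-- relation R N on raw tableaux whose order axioms hold on SYT_N.

record IsSYTPosetFamily (R : ℕ → Tab → Tab → Set) : Set₁ where
  field
    refl    : ∀ N T → 1 ≤ N → IsSYT N T → R N T T
    antisym : ∀ N S T → 1 ≤ N → IsSYT N S → IsSYT N T →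
              R N S T → R N T S → S ≡ T
    trans   : ∀ N S T U → 1 ≤ N → IsSYT N S → IsSYT N T → IsSYT N U →
              R N S T → R N T U → R N S U

-- Only the segment [i, i+1] matters: st(T_[i,i+1]) is the one-column tableau when i is a
-- descent of T and the one-row tableau otherwise. So if S ≤ T and i is a descent of S,
-- restriction to segments relates the column to st(T_[i,i+1]); were that the row, the
-- weak-order relation row ≤ column (from 12 ≤ 21 in S₂) and antisymmetry would identify them.
--
-- To compute st(T_[i,i+1]), follow the slides into the cells of T holding i-1, …, 1. Just
-- before the slide into the cell of k, the empty cells are exactly the cells of T with
-- entries at most k, since a slide only ever moves the entries 1 and 2 of the segment. The
-- invariant TwoCellSkew records that 1 and 2 sit at successive outer corners of the empty
-- cells, and whether 2 lies in a lower row than 1; every slide preserves it, and once no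
-- empty cell is left, 1 sits at the origin with 2 to its right or below it.

module Submission where

open import Defs
open import Data.Bool using (Bool; true; false; T; if_then_else_; _∨_)
open import Data.Bool.Properties using (T-≡; ∨-assoc; ∨-comm)
open import Data.Empty using (⊥; ⊥-elim)
open import Data.List
  using (List; []; _∷_; _++_; take; concat; map; upTo; downFrom; mapMaybe; catMaybes; foldl; reverse; length)
open import Data.List.Properties using (reverse-map; reverse-upTo; length-map; length-upTo)
open import Data.List.Membership.Propositional using (_∈_; _∉_)
open import Data.List.Membership.Propositional.Properties
  using (∈-map⁺; ∈-map⁻; ∈-upTo⁺; ∈-upTo⁻; ∈-++⁺ˡ; ∈-++⁺ʳ; ∈-++⁻)
open import Data.List.Relation.Unary.Any using (here; there)
open import Data.List.Relation.Unary.All using (All; []; _∷_)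
import Data.List.Relation.Unary.All as All
import Data.List.Relation.Unary.All.Properties as All
open import Data.List.Relation.Unary.AllPairs using ([]; _∷_)
open import Data.List.Relation.Unary.Linked using (Linked; []; [-]; _∷_)
import Data.List.Relation.Unary.Linked as Linked
open import Data.List.Relation.Unary.Unique.Propositional using (Unique)
import Data.List.Relation.Unary.Unique.Propositional.Properties as Unique
open import Data.List.Relation.Binary.Permutation.Propositional using (↭-refl; ↭-swap; ↭-sym; ↭⇒↭ₛ)
open import Data.List.Relation.Binary.Permutation.Propositional.Properties using (∈-resp-↭; ↭-length)
open import Data.Maybe using (Maybe; just; nothing; Is-just; maybe′; _>>=_)
open import Data.Maybe.Properties using (just-injective)
open import Data.Maybe.Relation.Unary.Any using (just)
open import Data.Nat using (ℕ; zero; suc; _≤_; _<_; _+_; _*_; _∸_; _<ᵇ_; _≟_; z≤n; s≤s)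
open import Data.Nat.Properties
  using ( suc-injective; ≤-refl; ≤-trans; <-trans; <-asym; <-cmp; <⇒≤; <⇒≢; >⇒≢; 1+n≢n; n≮n
        ; n<1+n; n≤1+n; m<n⇒m<1+n; m≤n⇒m<n∨m≡n; ≮⇒≥; ≤⇒≯; _<?_; <⇒<ᵇ; <ᵇ⇒<
        ; m+n∸n≡m; m+[n∸m]≡n; *-suc; +-comm )
open import Data.Product using (∃-syntax; _×_; _,_; proj₁; proj₂)
open import Data.Product.Properties using (≡-dec)
open import Data.Sum using (_⊎_; inj₁; inj₂)
open import Data.Unit using (tt)
open import Function using (_∘_; id; flip; Equivalence)
open import Relation.Binary.Construct.Closure.Transitive using ([_])
open import Relation.Binary.Definitions using (DecidableEquality; tri<; tri≈; tri>)
open import Relation.Binary.PropositionalEquality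
  using (_≡_; _≢_; _≗_; refl; sym; trans; cong; cong₂; subst; subst₂; module ≡-Reasoning)
open import Relation.Binary.PropositionalEquality.Properties using (setoid)
open import Data.List.Relation.Binary.Permutation.Setoid.Properties (setoid ℕ) using (Unique-resp-↭)
open import Relation.Nullary using (Dec; yes; no; does; ¬_; contradiction)
open import Relation.Nullary.Decidable using (dec-true; dec-false)

<⇒<ᵇ≡true : ∀ {m n} → m < n → (m <ᵇ n) ≡ true
<⇒<ᵇ≡true = T-≡ .Equivalence.to ∘ <⇒<ᵇ

≤⇒<ᵇ≡false : ∀ {m n} → n ≤ m → (m <ᵇ n) ≡ false
≤⇒<ᵇ≡false {m} {n} n≤m with m <ᵇ n in eq
... | false = refl
... | true  = contradiction (<ᵇ⇒< m n (subst T (sym eq) tt)) (≤⇒≯ n≤m)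

<ᵇ-sucˡ : ∀ {r b} → b ≢ suc r → (r <ᵇ b) ≡ (suc r <ᵇ b)
<ᵇ-sucˡ {zero}  {zero}        _    = refl
<ᵇ-sucˡ {zero}  {suc zero}    b≢1  = contradiction refl b≢1
<ᵇ-sucˡ {zero}  {suc (suc b)} _    = refl
<ᵇ-sucˡ {suc r} {zero}        _    = refl
<ᵇ-sucˡ {suc r} {suc b}       b≢r  = <ᵇ-sucˡ (b≢r ∘ cong suc)

<ᵇ-sucʳ : ∀ {a r} → a ≢ r → (a <ᵇ r) ≡ (a <ᵇ suc r)
<ᵇ-sucʳ {zero}  {zero}  a≢r = contradiction refl a≢r
<ᵇ-sucʳ {zero}  {suc r} _   = refl
<ᵇ-sucʳ {suc a} {zero}  _   = refl
<ᵇ-sucʳ {suc a} {suc r} a≢r = <ᵇ-sucʳ (a≢r ∘ cong suc)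

-- Cells of tables

Pos : Set
Pos = ℕ × ℕ

-- Opaque, so that unification does not get stuck on `does (p ≟ₚ q)` while p or q is unknown.
opaque
  _≟ₚ_ : DecidableEquality Pos
  _≟ₚ_ = ≡-dec _≟_ _≟_

entry : {A : Set} → List (List A) → Pos → Maybe A
entry []        _           = nothing
entry (row ∷ t) (zero  , c) = at row c
entry (row ∷ t) (suc r , c) = entry t (r , c)

entry-via-row : {A : Set} (t : List (List A)) (r c : ℕ) → entry t (r , c) ≡ (at t r >>= λ row → at row c)
entry-via-row []        r       c = refl
entry-via-row (row ∷ t) zero    c = refl
entry-via-row (row ∷ t) (suc r) c = entry-via-row t r c

cell-via-row : {A : Set} (t : List (List A)) (r c : ℕ) → cell t r c ≡ (at t r >>= λ row → at row c)
cell-via-row t r c with at t r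
... | nothing  = refl
... | just row = refl

cell≡entry : {A : Set} (t : List (List A)) (r c : ℕ) → cell t r c ≡ entry t (r , c)
cell≡entry t r c = trans (cell-via-row t r c) (sym (entry-via-row t r c))

_[_≔_] : {A : Set} → (Pos → A) → Pos → A → Pos → A
(f [ z ≔ a ]) p = if does (p ≟ₚ z) then a else f p

update-≡ : {A : Set} (f : Pos → A) (z : Pos) (a : A) → (f [ z ≔ a ]) z ≡ a
update-≡ f z a with z ≟ₚ z
... | yes _  = refl
... | no z≢z = contradiction refl z≢z

update-≢ : {A : Set} (f : Pos → A) {z p : Pos} (a : A) → p ≢ z → (f [ z ≔ a ]) p ≡ f p
update-≢ f {z} {p} a p≢z with p ≟ₚ z
... | yes p≡z = contradiction p≡z p≢z
... | no _    = refl

Represents : {A : Set} → List (List A) → (Pos → Maybe A) → Set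
Represents t f = ∀ p → entry t p ≡ f p

at-setAt-≡ : {A : Set} (row : List A) (c : ℕ) (a : A) → Is-just (at row c) → at (setAt row c a) c ≡ just a
at-setAt-≡ (x ∷ row) zero    a _ = refl
at-setAt-≡ (x ∷ row) (suc c) a j = at-setAt-≡ row c a j

at-setAt-≢ : {A : Set} (row : List A) {c d : ℕ} (a : A) → d ≢ c → at (setAt row c a) d ≡ at row d
at-setAt-≢ []        {c}     {d}     a d≢c = refl
at-setAt-≢ (x ∷ row) {zero}  {zero}  a d≢c = contradiction refl d≢c
at-setAt-≢ (x ∷ row) {zero}  {suc d} a d≢c = refl
at-setAt-≢ (x ∷ row) {suc c} {zero}  a d≢c = refl
at-setAt-≢ (x ∷ row) {suc c} {suc d} a d≢c = at-setAt-≢ row a (d≢c ∘ cong suc)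

entry-setCell-≡ : {A : Set} (t : List (List A)) (r c : ℕ) (a : A) →
                  Is-just (entry t (r , c)) → entry (setCell t r c a) (r , c) ≡ just a
entry-setCell-≡ (row ∷ t) zero    c a j = at-setAt-≡ row c a j
entry-setCell-≡ (row ∷ t) (suc r) c a j = entry-setCell-≡ t r c a j

entry-setCell-≢ : {A : Set} (t : List (List A)) (r c : ℕ) (a : A) {p : Pos} →
                  p ≢ (r , c) → entry (setCell t r c a) p ≡ entry t p
entry-setCell-≢ []        r       c a         p≢z = refl
entry-setCell-≢ (row ∷ t) zero    c a {zero  , d} p≢z = at-setAt-≢ row a (p≢z ∘ cong (0 ,_))
entry-setCell-≢ (row ∷ t) zero    c a {suc s , d} p≢z = refl
entry-setCell-≢ (row ∷ t) (suc r) c a {zero  , d} p≢z = refl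
entry-setCell-≢ (row ∷ t) (suc r) c a {suc s , d} p≢z =
  entry-setCell-≢ t r c a (p≢z ∘ cong (λ { (s , d) → suc s , d }))

Represents-setCell : {A : Set} (t : List (List A)) {f : Pos → Maybe A} (r c : ℕ) (a : A) →
                     Represents t f → Is-just (f (r , c)) → Represents (setCell t r c a) (f [ (r , c) ≔ just a ])
Represents-setCell t {f} r c a rep j p with p ≟ₚ (r , c)
... | yes refl = entry-setCell-≡ t r c a (subst Is-just (sym (rep (r , c))) j)
... | no p≢z   = trans (entry-setCell-≢ t r c a p≢z) (rep p)

update-Is-just : {A : Set} (f : Pos → Maybe A) {z p : Pos} (a : A) → Is-just (f p) → Is-just ((f [ z ≔ just a ]) p)
update-Is-just f {z} {p} a j with p ≟ₚ z
... | yes _ = just _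
... | no _  = j

Is-just-≡ : {A : Set} {m : Maybe A} {a : A} → m ≡ just a → Is-just m
Is-just-≡ refl = just _

≡just⇒≢just : {A : Set} {m : Maybe A} {x y : A} → m ≡ just x → x ≢ y → m ≢ just y
≡just⇒≢just refl x≢y = x≢y ∘ just-injective

≡nothing⇒≢just : {A : Set} {m : Maybe A} {y : A} → m ≡ nothing → m ≢ just y
≡nothing⇒≢just refl ()

at-take-< : {A : Set} (row : List A) {c d : ℕ} → d < c → at (take c row) d ≡ at row d
at-take-< []        {suc c} {d}     _         = refl
at-take-< (x ∷ row) {suc c} {zero}  _         = refl
at-take-< (x ∷ row) {suc c} {suc d} (s≤s d<c) = at-take-< row d<c

at-take-≥ : {A : Set} (row : List A) {c d : ℕ} → c ≤ d → at (take c row) d ≡ nothing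
at-take-≥ row       {zero}  {d}     _         = refl
at-take-≥ []        {suc c} {d}     _         = refl
at-take-≥ (x ∷ row) {suc c} {suc d} (s≤s c≤d) = at-take-≥ row c≤d

entry-truncate-≢ : {A : Set} (t : List (List A)) {r c s d : ℕ} → s ≢ r →
                   entry (modAt t r (take c)) (s , d) ≡ entry t (s , d)
entry-truncate-≢ []        {r}     {s = s}     s≢r = refl
entry-truncate-≢ (row ∷ t) {zero}  {s = zero}  s≢r = contradiction refl s≢r
entry-truncate-≢ (row ∷ t) {zero}  {s = suc s} s≢r = refl
entry-truncate-≢ (row ∷ t) {suc r} {s = zero}  s≢r = refl
entry-truncate-≢ (row ∷ t) {suc r} {s = suc s} s≢r = entry-truncate-≢ t (s≢r ∘ cong suc)

entry-truncate-< : {A : Set} (t : List (List A)) {r c d : ℕ} → d < c →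
                   entry (modAt t r (take c)) (r , d) ≡ entry t (r , d)
entry-truncate-< []        {r}     d<c = refl
entry-truncate-< (row ∷ t) {zero}  d<c = at-take-< row d<c
entry-truncate-< (row ∷ t) {suc r} d<c = entry-truncate-< t d<c

entry-truncate-≥ : {A : Set} (t : List (List A)) {r c d : ℕ} → c ≤ d →
                   entry (modAt t r (take c)) (r , d) ≡ nothing
entry-truncate-≥ []        {r}     c≤d = refl
entry-truncate-≥ (row ∷ t) {zero}  c≤d = at-take-≥ row c≤d
entry-truncate-≥ (row ∷ t) {suc r} c≤d = entry-truncate-≥ t c≤d

DownClosed : {A : Set} → List (List A) → Set
DownClosed t = ∀ {r c} → Is-just (entry t (suc r , c)) → Is-just (entry t (r , c))

entry-dropEmptyRows : {A : Set} (t : List (List A)) → DownClosed t →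
                      ∀ p → entry (dropEmptyRows t) p ≡ entry t p
entry-dropEmptyRows []               closed p           = refl
entry-dropEmptyRows ([] ∷ t)         closed p           =
  trans (entry-dropEmptyRows t closed p) (both-vacant p)
  where
  vacant-from : ∀ r {c} → ¬ Is-just (entry t (r , c))
  vacant-from zero    j with () ← closed j
  vacant-from (suc r) j = vacant-from r (closed j)
  vacant : ∀ p → entry t p ≡ nothing
  vacant (r , c) with entry t (r , c) | vacant-from r {c}
  ... | nothing | _  = refl
  ... | just _  | ¬j = contradiction (just _) ¬j
  both-vacant : ∀ p → entry t p ≡ entry ([] ∷ t) p
  both-vacant (zero  , c) = vacant (zero , c)
  both-vacant (suc r , c) = trans (vacant (suc r , c)) (sym (vacant (r , c)))
entry-dropEmptyRows ((x ∷ row) ∷ t) closed (zero  , c) = refl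
entry-dropEmptyRows ((x ∷ row) ∷ t) closed (suc r , c) = entry-dropEmptyRows t closed (r , c)

at-≗⇒≡ : {A : Set} (xs ys : List A) → (∀ c → at xs c ≡ at ys c) → xs ≡ ys
at-≗⇒≡ []       []       _  = refl
at-≗⇒≡ []       (y ∷ ys) eq with () ← eq 0
at-≗⇒≡ (x ∷ xs) []       eq with () ← eq 0
at-≗⇒≡ (x ∷ xs) (y ∷ ys) eq with refl ← eq 0 = cong (x ∷_) (at-≗⇒≡ xs ys (eq ∘ suc))

dropEmptyRows-vacant : {A : Set} (t : List (List A)) → (∀ p → entry t p ≡ nothing) → dropEmptyRows t ≡ []
dropEmptyRows-vacant []        vacant = refl
dropEmptyRows-vacant (row ∷ t) vacant with refl ← at-≗⇒≡ row [] (λ c → vacant (0 , c)) =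
  dropEmptyRows-vacant t (λ { (r , c) → vacant (suc r , c) })

dropEmptyRows-cong : {A : Set} (t u : List (List A)) → (∀ p → entry t p ≡ entry u p) →
                     dropEmptyRows t ≡ dropEmptyRows u
dropEmptyRows-cong []        u          eq = sym (dropEmptyRows-vacant u (sym ∘ eq))
dropEmptyRows-cong (row ∷ t) []         eq = dropEmptyRows-vacant (row ∷ t) eq
dropEmptyRows-cong (row ∷ t) (row′ ∷ u) eq
  with refl ← at-≗⇒≡ row row′ (λ c → eq (0 , c)) | nonEmpty row
     | dropEmptyRows-cong t u (λ { (r , c) → eq (suc r , c) })
... | true  | rest = cong (row ∷_) rest
... | false | rest = rest

at-catMaybes : {A : Set} (row : List (Maybe A)) → (∀ c → at row c ≢ just nothing) →
               ∀ c → at (catMaybes row) c ≡ (at row c >>= id)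
at-catMaybes []             no-hole c       = refl
at-catMaybes (nothing ∷ row) no-hole c      = contradiction refl (no-hole 0)
at-catMaybes (just x ∷ row) no-hole zero    = refl
at-catMaybes (just x ∷ row) no-hole (suc c) = at-catMaybes row (no-hole ∘ suc) c

entry-map-catMaybes : {A : Set} (t : List (List (Maybe A))) → (∀ p → entry t p ≢ just nothing) →
                      ∀ p → entry (map catMaybes t) p ≡ (entry t p >>= id)
entry-map-catMaybes []        no-hole p           = refl
entry-map-catMaybes (row ∷ t) no-hole (zero  , c) = at-catMaybes row (λ c → no-hole (0 , c)) c
entry-map-catMaybes (row ∷ t) no-hole (suc r , c) =
  entry-map-catMaybes t (λ { (r , c) → no-hole (suc r , c) }) (r , c)

at-∈ : {A : Set} (row : List A) {c : ℕ} {x : A} → at row c ≡ just x → x ∈ row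
at-∈ (y ∷ row) {zero}  refl = here refl
at-∈ (y ∷ row) {suc c} eq   = there (at-∈ row eq)

∈-at : {A : Set} {row : List A} {x : A} → x ∈ row → ∃[ c ] at row c ≡ just x
∈-at (here refl) = zero , refl
∈-at (there x∈)  = let c , eq = ∈-at x∈ in suc c , eq

entry-∈ : {A : Set} (t : List (List A)) {p : Pos} {x : A} → entry t p ≡ just x → x ∈ concat t
entry-∈ (row ∷ t) {zero  , c} eq = ∈-++⁺ˡ (at-∈ row eq)
entry-∈ (row ∷ t) {suc r , c} eq = ∈-++⁺ʳ row (entry-∈ t eq)

∈-entry : {A : Set} (t : List (List A)) {x : A} → x ∈ concat t → ∃[ p ] entry t p ≡ just x
∈-entry (row ∷ t) x∈ with ∈-++⁻ row x∈
... | inj₁ x∈row = let c , eq = ∈-at x∈row in (0 , c) , eq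
... | inj₂ x∈t   = let (r , c) , eq = ∈-entry t x∈t in (suc r , c) , eq

entry⇒InRow : ∀ (t : Tab) {r c x} → entry t (r , c) ≡ just x → InRow t r x
entry⇒InRow t {r} {c} eq with at t r in at-r | trans (sym (entry-via-row t r c)) eq
... | just row | eq′ = row , refl , at-∈ row eq′

InRow⇒entry : ∀ (t : Tab) {r x} → InRow t r x → ∃[ c ] entry t (r , c) ≡ just x
InRow⇒entry t {r} (row , at-r , x∈row) with c , eq ← ∈-at x∈row =
  c , trans (entry-via-row t r c) (trans (cong (_>>= _) at-r) eq)

module _ {B : Set} {g : ℕ → Maybe B} (upward : ∀ {x y} → x < y → g x ≡ nothing → g y ≡ nothing) where

  mapMaybe-after-vacant : ∀ {x xs} → Linked _<_ (x ∷ xs) → g x ≡ nothing → mapMaybe g xs ≡ []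
  mapMaybe-after-vacant {xs = []}     _         gx = refl
  mapMaybe-after-vacant {xs = y ∷ ys} (x<y ∷ l) gx rewrite upward x<y gx =
    mapMaybe-after-vacant l (upward x<y gx)

  at-after-vacant : ∀ {x xs} → Linked _<_ (x ∷ xs) → g x ≡ nothing → ∀ c → (at xs c >>= g) ≡ nothing
  at-after-vacant {xs = []}     _         gx c       = refl
  at-after-vacant {xs = y ∷ ys} (x<y ∷ l) gx zero    = upward x<y gx
  at-after-vacant {xs = y ∷ ys} (x<y ∷ l) gx (suc c) = at-after-vacant l (upward x<y gx) c

  at-mapMaybe : ∀ {row} → Linked _<_ row → ∀ c → at (mapMaybe g row) c ≡ (at row c >>= g)
  at-mapMaybe {[]}     _ c = refl
  at-mapMaybe {x ∷ xs} l c with g x in gx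
  at-mapMaybe {x ∷ xs} l zero    | just v  = sym gx
  at-mapMaybe {x ∷ xs} l (suc c) | just v  = at-mapMaybe (Linked.tail l) c
  at-mapMaybe {x ∷ xs} l zero    | nothing rewrite mapMaybe-after-vacant l gx = sym gx
  at-mapMaybe {x ∷ xs} l (suc c) | nothing rewrite mapMaybe-after-vacant l gx = sym (at-after-vacant l gx c)

  entry-map-mapMaybe : ∀ {t} → All (Linked _<_) t →
                       ∀ p → entry (map (mapMaybe g) t) p ≡ (entry t p >>= g)
  entry-map-mapMaybe {row ∷ t} (l ∷ _)  (zero  , c) = at-mapMaybe l c
  entry-map-mapMaybe {row ∷ t} (_ ∷ ls) (suc r , c) = entry-map-mapMaybe ls (r , c)
  entry-map-mapMaybe {[]}      _        p           = refl

-- Jeu de taquin slides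

data _◁_ : Pos → Pos → Set where
  left  : ∀ {r c} → (r , c) ◁ (r , suc c)
  above : ∀ {r c} → (r , c) ◁ (suc r , c)

◁-irrefl : ∀ {q p} → q ◁ p → q ≢ p
◁-irrefl left  ()
◁-irrefl above ()

◁-asym : ∀ {q p} → q ◁ p → ¬ p ◁ q
◁-asym left  ()
◁-asym above ()

_◁?_ : (q p : Pos) → Dec (q ◁ p)
(r , c) ◁? p with (r , suc c) ≟ₚ p | (suc r , c) ≟ₚ p
... | yes refl | _        = yes left
... | no _     | yes refl = yes above
... | no ¬left | no ¬above = no λ { left → ¬left refl ; above → ¬above refl }

slideAt : ℕ → Pos → STab → STab
slideAt f z = slide f (proj₁ z) (proj₂ z)

move : STab → Pos → Pos → ℕ → STab
move t z q a = setCell (setCell t (proj₁ z) (proj₂ z) (just a)) (proj₁ q) (proj₂ q) nothing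

data EmptyOrAbove (a : ℕ) : Maybe (Maybe ℕ) → Set where
  empty  : EmptyOrAbove a nothing
  larger : ∀ {b} → a < b → EmptyOrAbove a (just (just b))

slide-stop : ∀ {f} t {z} → (∀ {q} → z ◁ q → entry t q ≡ nothing) →
             slideAt (suc f) z t ≡ dropEmptyRows (modAt t (proj₁ z) (take (proj₂ z)))
slide-stop t {r , c} vacant
  rewrite cell≡entry t r (suc c) | vacant left | cell≡entry t (suc r) c | vacant above = refl

slide-step : ∀ {f} t {z q a} → z ◁ q → entry t q ≡ just (just a) →
             (∀ {q′} → z ◁ q′ → q′ ≢ q → EmptyOrAbove a (entry t q′)) →
             slideAt (suc f) z t ≡ slideAt f q (move t z q a)
slide-step t {r , c} left eq others
  rewrite cell≡entry t r (suc c) | eq | cell≡entry t (suc r) c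
  with entry t (suc r , c) | others above (λ ())
... | nothing       | empty      = refl
... | just (just b) | larger a<b rewrite <⇒<ᵇ≡true a<b = refl
slide-step t {r , c} above eq others
  rewrite cell≡entry t (suc r) c | eq | cell≡entry t r (suc c)
  with entry t (r , suc c) | others left (λ ())
... | nothing       | empty      = refl
... | just (just b) | larger a<b rewrite ≤⇒<ᵇ≡false (<⇒≤ a<b) = refl

-- Inner shapes and their fillings

_∪｛_｝ : (Pos → Bool) → Pos → Pos → Bool
(X ∪｛ z ｝) q = does (q ≟ₚ z) ∨ X q

module _ {X : Pos → Bool} {z : Pos} where

  ∈-∪-here : T ((X ∪｛ z ｝) z)
  ∈-∪-here with z ≟ₚ z
  ... | yes _  = tt
  ... | no z≢z = contradiction refl z≢z

  ∈-∪-there : ∀ {q} → T (X q) → T ((X ∪｛ z ｝) q)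
  ∈-∪-there {q} q∈X with q ≟ₚ z
  ... | yes _ = tt
  ... | no _  = q∈X

  ∈-∪⁻ : ∀ {q} → T ((X ∪｛ z ｝) q) → q ≡ z ⊎ T (X q)
  ∈-∪⁻ {q} q∈ with q ≟ₚ z
  ... | yes q≡z = inj₁ q≡z
  ... | no _    = inj₂ q∈

  ∉-∪ : ∀ {q} → q ≢ z → ¬ T (X q) → ¬ T ((X ∪｛ z ｝) q)
  ∉-∪ q≢z q∉X q∈ with ∈-∪⁻ q∈
  ... | inj₁ q≡z = q≢z q≡z
  ... | inj₂ q∈X = q∉X q∈X

Closed : (Pos → Bool) → Set
Closed X = ∀ {q p} → q ◁ p → T (X p) → T (X q)

record OuterCorner (X : Pos → Bool) (p : Pos) : Set where
  field
    outside   : ¬ T (X p)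
    supported : ∀ {q} → q ◁ p → T (X q)

Closed-∪ : ∀ {X z} → Closed X → OuterCorner X z → Closed (X ∪｛ z ｝)
Closed-∪ {X} {z} closed corner q◁p p∈ with ∈-∪⁻ {X} {z} p∈
... | inj₁ refl = ∈-∪-there {X} {z} (OuterCorner.supported corner q◁p)
... | inj₂ p∈X  = ∈-∪-there {X} {z} (closed q◁p p∈X)

neighbour-outside : ∀ {X z q} → Closed X → ¬ T (X z) → z ◁ q → ¬ T ((X ∪｛ z ｝) q)
neighbour-outside {X} {z} closed z∉X z◁q = ∉-∪ {X} {z} (◁-irrefl z◁q ∘ sym) (z∉X ∘ closed z◁q)

Closed-row : ∀ {X r c d} → Closed X → c ≤ d → T (X (r , d)) → T (X (r , c))
Closed-row closed c≤d ∈X with m≤n⇒m<n∨m≡n c≤d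
... | inj₂ refl        = ∈X
... | inj₁ (s≤s c≤d′) = Closed-row closed c≤d′ (closed left ∈X)

corner-in-row : ∀ {X r c p} → Closed X → T (X (r , c)) → ¬ T (X (r , suc c)) →
                OuterCorner X p → proj₁ p ≡ r → p ≡ (r , suc c)
corner-in-row {p = r , zero} closed ∈X ∉X corner refl =
  contradiction (Closed-row closed z≤n ∈X) (OuterCorner.outside corner)
corner-in-row {c = c} {p = r , suc d} closed ∈X ∉X corner refl with <-cmp d c
... | tri< d<c _ _  = contradiction (Closed-row closed d<c ∈X) (OuterCorner.outside corner)
... | tri≈ _ refl _ = refl
... | tri> _ _ c<d  = contradiction (Closed-row closed c<d (OuterCorner.supported corner left)) ∉X

OuterCorner-≗ : ∀ {X Y p} → X ≗ Y → OuterCorner X p → OuterCorner Y p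
OuterCorner-≗ {p = p} X≗Y corner = record
  { outside   = OuterCorner.outside corner ∘ subst T (sym (X≗Y p))
  ; supported = λ {q} q◁p → subst T (X≗Y q) (OuterCorner.supported corner q◁p)
  }

OuterCorner-∪⁻ : ∀ {X w p} → ¬ w ◁ p → OuterCorner (X ∪｛ w ｝) p → OuterCorner X p
OuterCorner-∪⁻ {X} {w} {p} ¬w◁p corner = record
  { outside   = OuterCorner.outside corner ∘ ∈-∪-there {X} {w}
  ; supported = supported
  }
  where
  supported : ∀ {q} → q ◁ p → T (X q)
  supported q◁p with ∈-∪⁻ {X} {w} (OuterCorner.supported corner q◁p)
  ... | inj₁ refl = contradiction q◁p ¬w◁p
  ... | inj₂ q∈X  = q∈X

OuterCorner-∪⁺ : ∀ {X w p} → p ≢ w → OuterCorner X p → OuterCorner (X ∪｛ w ｝) p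
OuterCorner-∪⁺ {X} {w} p≢w corner = record
  { outside   = ∉-∪ {X} {w} p≢w (OuterCorner.outside corner)
  ; supported = ∈-∪-there {X} {w} ∘ OuterCorner.supported corner
  }

∪-swap : ∀ X a b → ((X ∪｛ a ｝) ∪｛ b ｝) ≗ ((X ∪｛ b ｝) ∪｛ a ｝)
∪-swap X a b q = trans (sym (∨-assoc (does (q ≟ₚ b)) (does (q ≟ₚ a)) (X q)))
                 (trans (cong (_∨ X q) (∨-comm (does (q ≟ₚ b)) (does (q ≟ₚ a))))
                        (∨-assoc (does (q ≟ₚ a)) (does (q ≟ₚ b)) (X q)))

∪-≗ : ∀ {X Y} → X ≗ Y → ∀ z → (X ∪｛ z ｝) ≗ (Y ∪｛ z ｝)
∪-≗ X≗Y z q = cong (does (q ≟ₚ z) ∨_) (X≗Y q)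

occupied : (Pos → Bool) → Pos → Pos → Pos → Bool
occupied X A B = (X ∪｛ A ｝) ∪｛ B ｝

∉-occupied : ∀ X A B {p} → p ≢ A → p ≢ B → ¬ T (X p) → ¬ T (occupied X A B p)
∉-occupied X A B p≢A p≢B p∉X = ∉-∪ {X ∪｛ A ｝} {B} p≢B (∉-∪ {X} {A} p≢A p∉X)

holes : (Pos → Bool) → Pos → Maybe (Maybe ℕ)
holes X p = if X p then just nothing else nothing

layout : (Pos → Bool) → Pos → Pos → Pos → Maybe (Maybe ℕ)
layout X A B = (holes X [ B ≔ just (just 2) ]) [ A ≔ just (just 1) ]

module _ (X : Pos → Bool) (A B : Pos) where

  layout-vacant : ∀ p → ¬ T (occupied X A B p) → layout X A B p ≡ nothing
  layout-vacant p with p ≟ₚ B | p ≟ₚ A | X p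
  ... | yes _ | yes _ | _     = λ ∉ → contradiction tt ∉
  ... | yes _ | no _  | _     = λ ∉ → contradiction tt ∉
  ... | no _  | yes _ | _     = λ ∉ → contradiction tt ∉
  ... | no _  | no _  | true  = λ ∉ → contradiction tt ∉
  ... | no _  | no _  | false = λ _ → refl

  layout-occupied : ∀ p → Is-just (layout X A B p) → T (occupied X A B p)
  layout-occupied p with p ≟ₚ B | p ≟ₚ A | X p
  ... | yes _ | yes _ | _     = λ _ → tt
  ... | yes _ | no _  | _     = λ _ → tt
  ... | no _  | yes _ | _     = λ _ → tt
  ... | no _  | no _  | true  = λ _ → tt
  ... | no _  | no _  | false = λ ()

  occupied-layout : ∀ p → T (occupied X A B p) → Is-just (layout X A B p)
  occupied-layout p with p ≟ₚ B | p ≟ₚ A | X p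
  ... | yes _ | yes _ | _     = λ _ → just tt
  ... | yes _ | no _  | _     = λ _ → just tt
  ... | no _  | yes _ | _     = λ _ → just tt
  ... | no _  | no _  | true  = λ _ → just tt
  ... | no _  | no _  | false = λ ()

  layout-∪-≢ : ∀ {w} p → p ≢ w → layout (X ∪｛ w ｝) A B p ≡ layout X A B p
  layout-∪-≢ {w} p p≢w with p ≟ₚ w
  ... | yes p≡w = contradiction p≡w p≢w
  ... | no _    = refl

  layout-move-one : ∀ z → z ≢ A → A ≢ B →
    (layout (X ∪｛ z ｝) A B [ z ≔ just (just 1) ]) [ A ≔ just nothing ] ≗ layout (X ∪｛ A ｝) z B
  layout-move-one z z≢A A≢B p with p ≟ₚ A | p ≟ₚ z | p ≟ₚ B
  ... | yes p≡A | yes p≡z | _       = contradiction (trans (sym p≡z) p≡A) z≢A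
  ... | yes p≡A | no _    | yes p≡B = contradiction (trans (sym p≡A) p≡B) A≢B
  ... | yes _   | no _    | no _    = refl
  ... | no _    | yes _   | _       = refl
  ... | no _    | no _    | _       = refl

  layout-move-two : ∀ z → z ≢ A → z ≢ B → A ≢ B →
    (layout (X ∪｛ z ｝) A B [ z ≔ just (just 2) ]) [ B ≔ just nothing ] ≗ layout (X ∪｛ B ｝) A z
  layout-move-two z z≢A z≢B A≢B p with p ≟ₚ B | p ≟ₚ z | p ≟ₚ A
  ... | yes p≡B | yes p≡z | _       = contradiction (trans (sym p≡z) p≡B) z≢B
  ... | yes p≡B | no _    | yes p≡A = contradiction (trans (sym p≡A) p≡B) A≢B
  ... | yes _   | no _    | no _    = refl
  ... | no _    | yes p≡z | yes p≡A = contradiction (trans (sym p≡z) p≡A) z≢A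
  ... | no _    | yes _   | no _    = refl
  ... | no _    | no _    | _       = refl

  layout-one : layout X A B A ≡ just (just 1)
  layout-one = update-≡ (holes X [ B ≔ just (just 2) ]) A _

  layout-two : A ≢ B → layout X A B B ≡ just (just 2)
  layout-two A≢B = trans (update-≢ (holes X [ B ≔ just (just 2) ]) _ (A≢B ∘ sym)) (update-≡ (holes X) B _)

  layout-hole : ∀ {p} → p ≢ A → p ≢ B → T (X p) → layout X A B p ≡ just nothing
  layout-hole {p} p≢A p≢B p∈X with p ≟ₚ A | p ≟ₚ B | X p
  ... | yes p≡A | _       | _     = contradiction p≡A p≢A
  ... | no _    | yes p≡B | _     = contradiction p≡B p≢B
  ... | no _    | no _    | true  = refl

layout-neighbour : ∀ X A B {w q} → Closed X → ¬ T (X w) → w ◁ q → q ≢ A → q ≢ B →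
                   layout (X ∪｛ w ｝) A B q ≡ nothing
layout-neighbour X A B {w} {q} closed w∉X w◁q q≢A q≢B =
  layout-vacant (X ∪｛ w ｝) A B q
    (∉-occupied (X ∪｛ w ｝) A B q≢A q≢B (neighbour-outside closed w∉X w◁q))

layout-≗ : ∀ {X Y} → X ≗ Y → ∀ A B → layout X A B ≗ layout Y A B
layout-≗ X≗Y A B p with p ≟ₚ A | p ≟ₚ B
... | yes _ | _     = refl
... | no _  | yes _ = refl
... | no _  | no _  = cong (λ b → if b then just nothing else nothing) (X≗Y p)

Closed-occupied : ∀ {X A B} → Closed X → OuterCorner X A → OuterCorner (X ∪｛ A ｝) B →
                  Closed (occupied X A B)
Closed-occupied closed one two = Closed-∪ (Closed-∪ closed one) two

Represents-≗ : ∀ (t : STab) {f g} → Represents t f → f ≗ g → Represents t g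
Represents-≗ t rep f≗g p = trans (rep p) (f≗g p)

Represents-dropEmptyRows : ∀ {X A B} u → Closed (occupied X A B) →
  Represents u (layout X A B) → Represents (dropEmptyRows u) (layout X A B)
Represents-dropEmptyRows {X} {A} {B} u closed rep p =
  trans (entry-dropEmptyRows u down-closed p) (rep p)
  where
  down-closed : DownClosed u
  down-closed {r} {c} j rewrite rep (r , c) =
    occupied-layout X A B _ (closed above (layout-occupied X A B _ (subst Is-just (rep (suc r , c)) j)))

Represents-move : ∀ (t : STab) {f} z q a → Represents t f → Is-just (f z) → Is-just (f q) →
  Represents (move t z q a) ((f [ z ≔ just (just a) ]) [ q ≔ just nothing ])
Represents-move t {f} (r , c) (s , d) a rep jz jq =
  Represents-setCell (setCell t r c (just a)) s d nothing (Represents-setCell t r c (just a) rep jz)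
                     (update-Is-just f (just a) jq)

slide-stop-layout : ∀ {X A B w} t f → Closed X → OuterCorner X A → OuterCorner (X ∪｛ A ｝) B →
  ¬ T (occupied X A B w) → Represents t (layout (X ∪｛ w ｝) A B) →
  Represents (slideAt (suc f) w t) (layout X A B)
slide-stop-layout {X} {A} {B} {w@(r , c)} t f closed one two w∉ rep
  = subst (λ u → Represents u (layout X A B)) (sym (slide-stop {f} t vacant-neighbour))
          (Represents-dropEmptyRows (modAt t r (take c)) occupied-closed truncated)
  where
  occupied-closed : Closed (occupied X A B)
  occupied-closed = Closed-occupied closed one two
  vacant-neighbour : ∀ {q} → w ◁ q → entry t q ≡ nothing
  vacant-neighbour {q} w◁q =
    trans (rep q) (trans (layout-∪-≢ X A B q (◁-irrefl w◁q ∘ sym))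
                         (layout-vacant X A B q (w∉ ∘ occupied-closed w◁q)))
  truncated : Represents (modAt t r (take c)) (layout X A B)
  truncated (s , d) with s ≟ r
  ... | no s≢r = trans (entry-truncate-≢ t s≢r)
                       (trans (rep (s , d)) (layout-∪-≢ X A B (s , d) (s≢r ∘ cong proj₁)))
  ... | yes refl with d <? c
  ...   | yes d<c = trans (entry-truncate-< t d<c)
                          (trans (rep (s , d)) (layout-∪-≢ X A B (s , d) (<⇒≢ d<c ∘ cong proj₂)))
  ...   | no d≮c  = trans (entry-truncate-≥ t (≮⇒≥ d≮c))
                          (sym (layout-vacant X A B (s , d) (w∉ ∘ Closed-row occupied-closed (≮⇒≥ d≮c))))

-- Two-cell skew tableaux

record TwoCellSkew (X : Pos → Bool) (descent : Bool) (t : STab) : Set where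
  field
    one two    : Pos
    represents : Represents t (layout X one two)
    one-corner : OuterCorner X one
    two-corner : OuterCorner (X ∪｛ one ｝) two
    rows       : (proj₁ one <ᵇ proj₁ two) ≡ descent

TwoCellSkew-≗ : ∀ {X Y d t} → X ≗ Y → TwoCellSkew X d t → TwoCellSkew Y d t
TwoCellSkew-≗ {t = t} X≗Y s = record
  { one        = one
  ; two        = two
  ; represents = Represents-≗ t represents (layout-≗ X≗Y one two)
  ; one-corner = OuterCorner-≗ X≗Y one-corner
  ; two-corner = OuterCorner-≗ (∪-≗ X≗Y one) two-corner
  ; rows       = rows
  }
  where open TwoCellSkew s

rows-both-moved : ∀ {z A B} → z ◁ A → A ◁ B → (∀ {q} → z ◁ q → q ◁ B → q ≡ A) →
                  (proj₁ z <ᵇ proj₁ A) ≡ (proj₁ A <ᵇ proj₁ B)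
rows-both-moved left  left  _      = refl
rows-both-moved above above _      = refl
rows-both-moved left  above square with () ← square above left
rows-both-moved above left  square with () ← square left above

rows-one-moved : ∀ {Y z A B} → Closed Y → T (Y A) → (∀ {q} → z ◁ q → q ≢ A → ¬ T (Y q)) →
                 OuterCorner Y B → z ◁ A → ¬ A ◁ B →
                 (proj₁ z <ᵇ proj₁ B) ≡ (proj₁ A <ᵇ proj₁ B)
rows-one-moved closed A∈Y others B-corner left  ¬A◁B = refl
rows-one-moved closed A∈Y others B-corner above ¬A◁B = <ᵇ-sucˡ λ B-row →
  ¬A◁B (subst (_ ◁_) (sym (corner-in-row closed A∈Y (others left (λ ()) ∘ closed above) B-corner B-row)) left)

rows-two-moved : ∀ {Y z A B} → Closed Y → T (Y z) → (∀ {q} → z ◁ q → ¬ T (Y q)) →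
                 OuterCorner Y A → ¬ z ◁ A → z ◁ B →
                 (proj₁ A <ᵇ proj₁ z) ≡ (proj₁ A <ᵇ proj₁ B)
rows-two-moved closed z∈Y others A-corner ¬z◁A left  = refl
rows-two-moved closed z∈Y others A-corner ¬z◁A above = <ᵇ-sucʳ λ A-row →
  ¬z◁A (subst (_ ◁_) (sym (corner-in-row closed z∈Y (others left) A-corner A-row)) left)

module _ {H : Pos → Bool} (H-closed : Closed H) {z : Pos} (z-corner : OuterCorner H z) where

  private
    X₀ : Pos → Bool
    X₀ = H ∪｛ z ｝
    z∉H : ¬ T (H z)
    z∉H = OuterCorner.outside z-corner
    z∈X₀ : T (X₀ z)
    z∈X₀ = ∈-∪-here {H} {z}
    X₀-closed : Closed X₀
    X₀-closed = Closed-∪ H-closed z-corner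
    z-neighbour-outside : ∀ {q} → z ◁ q → ¬ T (X₀ q)
    z-neighbour-outside = neighbour-outside H-closed z∉H

  module SlideFrom {d t} (s : TwoCellSkew X₀ d t) (f : ℕ) where
    open TwoCellSkew s renaming (one to A; two to B; one-corner to A-corner; two-corner to B-corner)

    A∉X₀ : ¬ T (X₀ A)
    A∉X₀ = OuterCorner.outside A-corner
    B∉X₀A : ¬ T ((X₀ ∪｛ A ｝) B)
    B∉X₀A = OuterCorner.outside B-corner
    B∉X₀ : ¬ T (X₀ B)
    B∉X₀ = B∉X₀A ∘ ∈-∪-there {X₀} {A}
    A≢B : A ≢ B
    A≢B refl = B∉X₀A (∈-∪-here {X₀} {A})
    z≢A : z ≢ A
    z≢A refl = A∉X₀ z∈X₀
    z≢B : z ≢ B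
    z≢B refl = B∉X₀ z∈X₀

    t-one : entry t A ≡ just (just 1)
    t-one = trans (represents A) (layout-one X₀ A B)
    t-two : entry t B ≡ just (just 2)
    t-two = trans (represents B) (layout-two X₀ A B A≢B)
    t-hole : entry t z ≡ just nothing
    t-hole = trans (represents z) (layout-hole X₀ A B z≢A z≢B z∈X₀)

    t-represents-move : ∀ q v → Is-just (layout X₀ A B q) →
      Represents (move t z q v) ((layout X₀ A B [ z ≔ just (just v) ]) [ q ≔ just nothing ])
    t-represents-move q v = Represents-move t z q v represents (Is-just-≡ (trans (sym (represents z)) t-hole))

    module FirstMoveOfOne (z◁A : z ◁ A) where
      t₁ : STab
      t₁ = move t z A 1

      t₁-represents : Represents t₁ (layout (H ∪｛ A ｝) z B)
      t₁-represents = Represents-≗ t₁ (t-represents-move A 1 (Is-just-≡ (layout-one X₀ A B)))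
                                      (layout-move-one H A B z z≢A A≢B)

      step₁ : slideAt (3 + f) z t ≡ slideAt (2 + f) A t₁
      step₁ = slide-step t z◁A t-one others
        where
        others : ∀ {q} → z ◁ q → q ≢ A → EmptyOrAbove 1 (entry t q)
        others {q} z◁q q≢A with q ≟ₚ B
        ... | yes refl = subst (EmptyOrAbove 1) (sym t-two) (larger (s≤s (s≤s z≤n)))
        ... | no q≢B rewrite represents q | layout-neighbour H A B H-closed z∉H z◁q q≢A q≢B = empty

      two-follows : A ◁ B → TwoCellSkew H d (slideAt (2 + f) A t₁)
      two-follows A◁B = subst (TwoCellSkew H d) (sym step₂) record
        { one        = z
        ; two        = A
        ; represents = slide-stop-layout t₂ f H-closed z-corner A-corner B∉X₀A t₂-represents
        ; one-corner = z-corner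
        ; two-corner = A-corner
        ; rows       = trans (rows-both-moved z◁A A◁B square) rows
        }
        where
        t₂ : STab
        t₂ = move t₁ A B 2
        t₂-represents : Represents t₂ (layout (H ∪｛ B ｝) z A)
        t₂-represents = Represents-≗ t₂
          (Represents-move t₁ A B 2 t₁-represents
            (Is-just-≡ (layout-hole (H ∪｛ A ｝) z B (z≢A ∘ sym) A≢B (∈-∪-here {H} {A})))
            (Is-just-≡ (layout-two (H ∪｛ A ｝) z B z≢B)))
          (layout-move-two H z B A (z≢A ∘ sym) A≢B z≢B)
        step₂ : slideAt (2 + f) A t₁ ≡ slideAt (1 + f) B t₂
        step₂ = slide-step t₁ A◁B (trans (t₁-represents B) (layout-two (H ∪｛ A ｝) z B z≢B)) others
          where
          others : ∀ {q} → A ◁ q → q ≢ B → EmptyOrAbove 2 (entry t₁ q)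
          others {q} A◁q q≢B
            rewrite t₁-represents q
                  | layout-neighbour H z B H-closed (A∉X₀ ∘ ∈-∪-there {H} {z}) A◁q
                      (λ { refl → ◁-asym z◁A A◁q }) q≢B = empty
        square : ∀ {q} → z ◁ q → q ◁ B → q ≡ A
        square {q} z◁q q◁B with ∈-∪⁻ {X₀} {A} (OuterCorner.supported B-corner q◁B)
        ... | inj₁ q≡A  = q≡A
        ... | inj₂ q∈X₀ = contradiction q∈X₀ (z-neighbour-outside z◁q)

      two-stays : ¬ A ◁ B → TwoCellSkew H d (slideAt (2 + f) A t₁)
      two-stays ¬A◁B = record
        { one        = z
        ; two        = B
        ; represents = slide-stop-layout t₁ (1 + f) H-closed z-corner B-corner′
                         (∉-∪ {X₀} {B} A≢B A∉X₀) t₁-represents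
        ; one-corner = z-corner
        ; two-corner = B-corner′
        ; rows       = trans (rows-one-moved (Closed-∪ X₀-closed A-corner) (∈-∪-here {X₀} {A}) others
                                B-corner z◁A ¬A◁B) rows
        }
        where
        B-corner′ : OuterCorner X₀ B
        B-corner′ = OuterCorner-∪⁻ ¬A◁B B-corner
        others : ∀ {q} → z ◁ q → q ≢ A → ¬ T ((X₀ ∪｛ A ｝) q)
        others z◁q q≢A = ∉-∪ {X₀} {A} q≢A (z-neighbour-outside z◁q)

    one-moves : z ◁ A → TwoCellSkew H d (slideAt (3 + f) z t)
    one-moves z◁A with A ◁? B
    ... | yes A◁B = subst (TwoCellSkew H d) (sym step₁) (two-follows A◁B)
      where open FirstMoveOfOne z◁A
    ... | no ¬A◁B = subst (TwoCellSkew H d) (sym step₁) (two-stays ¬A◁B)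
      where open FirstMoveOfOne z◁A

    two-moves : ¬ z ◁ A → z ◁ B → TwoCellSkew H d (slideAt (3 + f) z t)
    two-moves ¬z◁A z◁B = subst (TwoCellSkew H d) (sym step) record
      { one        = A
      ; two        = z
      ; represents = slide-stop-layout t₁ (1 + f) H-closed A-corner′ z-corner′
                       (∉-occupied H A z (A≢B ∘ sym) (z≢B ∘ sym) (B∉X₀ ∘ ∈-∪-there {H} {z}))
                       t₁-represents
      ; one-corner = A-corner′
      ; two-corner = z-corner′
      ; rows       = trans (rows-two-moved X₀-closed z∈X₀ z-neighbour-outside A-corner ¬z◁A z◁B) rows
      }
      where
      t₁ : STab
      t₁ = move t z B 2
      t₁-represents : Represents t₁ (layout (H ∪｛ B ｝) A z)
      t₁-represents = Represents-≗ t₁ (t-represents-move B 2 (Is-just-≡ (layout-two X₀ A B A≢B)))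
                                      (layout-move-two H A B z z≢A z≢B A≢B)
      step : slideAt (3 + f) z t ≡ slideAt (2 + f) B t₁
      step = slide-step t z◁B t-two others
        where
        others : ∀ {q} → z ◁ q → q ≢ B → EmptyOrAbove 2 (entry t q)
        others {q} z◁q q≢B rewrite represents q
          | layout-neighbour H A B H-closed z∉H z◁q (λ { refl → ¬z◁A z◁q }) q≢B = empty
      A-corner′ : OuterCorner H A
      A-corner′ = OuterCorner-∪⁻ ¬z◁A A-corner
      z-corner′ : OuterCorner (H ∪｛ A ｝) z
      z-corner′ = OuterCorner-∪⁺ z≢A z-corner

    none-moves : ¬ z ◁ A → ¬ z ◁ B → TwoCellSkew H d (slideAt (3 + f) z t)
    none-moves ¬z◁A ¬z◁B = record
      { one        = A
      ; two        = B
      ; represents = slide-stop-layout t (2 + f) H-closed A-corner′ B-corner′ z∉occupied represents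
      ; one-corner = A-corner′
      ; two-corner = B-corner′
      ; rows       = rows
      }
      where
      A-corner′ : OuterCorner H A
      A-corner′ = OuterCorner-∪⁻ ¬z◁A A-corner
      B-corner′ : OuterCorner (H ∪｛ A ｝) B
      B-corner′ = OuterCorner-∪⁻ ¬z◁B (OuterCorner-≗ (∪-swap H z A) B-corner)
      z∉occupied : ¬ T (occupied H A B z)
      z∉occupied = ∉-occupied H A B z≢A z≢B z∉H

  -- Only the entries 1 and 2 can move, so three units of fuel suffice.
  slide-TwoCellSkew : ∀ {d t} f → TwoCellSkew X₀ d t → TwoCellSkew H d (slideAt (3 + f) z t)
  slide-TwoCellSkew f s with z ◁? TwoCellSkew.one s | z ◁? TwoCellSkew.two s
  ... | yes z◁A | _       = SlideFrom.one-moves s f z◁A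
  ... | no ¬z◁A | yes z◁B = SlideFrom.two-moves s f ¬z◁A z◁B
  ... | no ¬z◁A | no ¬z◁B = SlideFrom.none-moves s f ¬z◁A ¬z◁B

∅ : Pos → Bool
∅ _ = false

row₁₂ column₁₂ : Tab
row₁₂    = (1 ∷ 2 ∷ []) ∷ []
column₁₂ = (1 ∷ []) ∷ (2 ∷ []) ∷ []

OuterCorner-∅ : ∀ {p} → OuterCorner ∅ p → p ≡ (0 , 0)
OuterCorner-∅ {zero  , zero}  corner = refl
OuterCorner-∅ {r     , suc c} corner = ⊥-elim (OuterCorner.supported corner left)
OuterCorner-∅ {suc r , zero}  corner = ⊥-elim (OuterCorner.supported corner above)

OuterCorner-origin : ∀ {p} → OuterCorner (∅ ∪｛ (0 , 0) ｝) p → p ≡ (0 , 1) ⊎ p ≡ (1 , 0)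
OuterCorner-origin {zero , zero} corner = contradiction (∈-∪-here {∅} {0 , 0}) (OuterCorner.outside corner)
OuterCorner-origin {zero , suc c} corner with ∈-∪⁻ {∅} {0 , 0} (OuterCorner.supported corner left)
... | inj₁ refl = inj₁ refl
OuterCorner-origin {suc r , zero} corner with ∈-∪⁻ {∅} {0 , 0} (OuterCorner.supported corner above)
... | inj₁ refl = inj₂ refl
OuterCorner-origin {suc r , suc c} corner with ∈-∪⁻ {∅} {0 , 0} (OuterCorner.supported corner left)
... | inj₁ ()

layout-∅-no-hole : ∀ A B p → layout ∅ A B p ≢ just nothing
layout-∅-no-hole A B p with p ≟ₚ A | p ≟ₚ B
... | yes _ | _     = λ ()
... | no _  | yes _ = λ ()
... | no _  | no _  = λ ()

row₁₂-represents : ∀ p → entry row₁₂ p ≡ (layout ∅ (0 , 0) (0 , 1) p >>= id)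
row₁₂-represents p with p ≟ₚ (0 , 0) | p ≟ₚ (0 , 1)
... | yes refl | _        = refl
... | no _     | yes refl = refl
... | no p≢00  | no p≢01  = vacant p p≢00 p≢01
  where
  vacant : ∀ p → p ≢ (0 , 0) → p ≢ (0 , 1) → entry row₁₂ p ≡ nothing
  vacant (zero  , zero)        p≢00 _    = contradiction refl p≢00
  vacant (zero  , suc zero)    _    p≢01 = contradiction refl p≢01
  vacant (zero  , suc (suc c)) _    _    = refl
  vacant (suc r , c)           _    _    = refl

column₁₂-represents : ∀ p → entry column₁₂ p ≡ (layout ∅ (0 , 0) (1 , 0) p >>= id)
column₁₂-represents p with p ≟ₚ (0 , 0) | p ≟ₚ (1 , 0)
... | yes refl | _        = refl
... | no _     | yes refl = refl
... | no p≢00  | no p≢10  = vacant p p≢00 p≢10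
  where
  vacant : ∀ p → p ≢ (0 , 0) → p ≢ (1 , 0) → entry column₁₂ p ≡ nothing
  vacant (zero        , zero)  p≢00 _    = contradiction refl p≢00
  vacant (zero        , suc c) _    _    = refl
  vacant (suc zero    , zero)  _    p≢10 = contradiction refl p≢10
  vacant (suc zero    , suc c) _    _    = refl
  vacant (suc (suc r) , c)     _    _    = refl

Represents-map-catMaybes : ∀ t {A B} → Represents t (layout ∅ A B) →
                           Represents (map catMaybes t) (λ p → layout ∅ A B p >>= id)
Represents-map-catMaybes t {A} {B} represents p =
  trans (entry-map-catMaybes t (λ p → layout-∅-no-hole A B p ∘ trans (sym (represents p))) p)
        (cong (_>>= id) (represents p))

rectified-shape : ∀ {d t} → TwoCellSkew ∅ d t →
                  dropEmptyRows (map catMaybes t) ≡ (if d then column₁₂ else row₁₂)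
rectified-shape {t = t} record { one = one ; two = two ; represents = represents
                         ; one-corner = one-corner ; two-corner = two-corner ; rows = rows }
  with refl ← OuterCorner-∅ one-corner
  with OuterCorner-origin two-corner
... | inj₁ refl with refl ← rows = dropEmptyRows-cong (map catMaybes t) row₁₂ λ p →
  trans (Represents-map-catMaybes t represents p) (sym (row₁₂-represents p))
... | inj₂ refl with refl ← rows = dropEmptyRows-cong (map catMaybes t) column₁₂ λ p →
  trans (Represents-map-catMaybes t represents p) (sym (column₁₂-represents p))

-- Standard Young tableaux

Unique-++⁻ˡ : {A : Set} (xs : List A) {ys : List A} → Unique (xs ++ ys) → Unique xs
Unique-++⁻ˡ []       _          = []
Unique-++⁻ˡ (x ∷ xs) (x∉ ∷ u) = All.++⁻ˡ xs x∉ ∷ Unique-++⁻ˡ xs u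

Unique-++⁻ʳ : {A : Set} (xs : List A) {ys : List A} → Unique (xs ++ ys) → Unique ys
Unique-++⁻ʳ []       u        = u
Unique-++⁻ʳ (x ∷ xs) (_ ∷ u) = Unique-++⁻ʳ xs u

Unique-++-disjoint : {A : Set} (xs : List A) {ys : List A} {x : A} → Unique (xs ++ ys) → x ∈ xs → x ∉ ys
Unique-++-disjoint (x ∷ xs) (x∉ ∷ u) (here refl) x∈ys = All.lookup (All.++⁻ʳ xs x∉) x∈ys refl
Unique-++-disjoint (y ∷ xs) (_ ∷ u)  (there x∈)  = Unique-++-disjoint xs u x∈

posIn-at : (row : List ℕ) {c x : ℕ} → Unique row → at row c ≡ just x → posIn x row ≡ just c
posIn-at (y ∷ row) {zero}  {x} _         refl rewrite dec-true (x ≟ x) refl = refl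
posIn-at (y ∷ row) {suc c} {x} (y∉ ∷ u) eq
  rewrite dec-false (x ≟ y) (λ { refl → All.lookup y∉ (at-∈ row eq) refl }) | posIn-at row u eq = refl

posIn-∉ : (row : List ℕ) {x : ℕ} → x ∉ row → posIn x row ≡ nothing
posIn-∉ []        x∉ = refl
posIn-∉ (y ∷ row) {x} x∉ rewrite dec-false (x ≟ y) (x∉ ∘ here) | posIn-∉ row (x∉ ∘ there) = refl

cellOf-unique : (t : Tab) {p : Pos} {x : ℕ} → Unique (concat t) → entry t p ≡ just x → cellOf x t ≡ p
cellOf-unique (row ∷ t) {zero , c} u eq rewrite posIn-at row (Unique-++⁻ˡ row u) eq = refl
cellOf-unique (row ∷ t) {suc r , c} u eq
  rewrite posIn-∉ row (λ x∈row → Unique-++-disjoint row u x∈row (entry-∈ t eq))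
        | cellOf-unique t (Unique-++⁻ʳ row u) eq = refl

Linked-at : (row : List ℕ) {c y : ℕ} → Linked _<_ row → at row (suc c) ≡ just y →
            ∃[ x ] at row c ≡ just x × x < y
Linked-at (x ∷ z ∷ row) {zero}  (x<z ∷ _) refl = x , refl , x<z
Linked-at (x ∷ z ∷ row) {suc c} (_ ∷ l)   eq   = Linked-at (z ∷ row) l eq

rows-increasing : (t : Tab) {r c y : ℕ} → All (Linked _<_) t → entry t (r , suc c) ≡ just y →
                  ∃[ x ] entry t (r , c) ≡ just x × x < y
rows-increasing (row ∷ t) {zero}  (l ∷ _)  eq = Linked-at row l eq
rows-increasing (row ∷ t) {suc r} (_ ∷ ls) eq = rows-increasing t ls eq

range-∈ : ∀ {n x} → x ∈ range n → 1 ≤ x × x ≤ n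
range-∈ x∈ with _ , y∈ , refl ← ∈-map⁻ suc x∈ = s≤s z≤n , ∈-upTo⁻ y∈

∈-range : ∀ {n x} → 1 ≤ x → x ≤ n → x ∈ range n
∈-range {x = suc x} _ x≤n = ∈-map⁺ suc (∈-upTo⁺ x≤n)

-- The cell map local to `segment`, so `segment i j T` unfolds to
-- `dropEmptyRows (map (mapMaybe (segmentCell i j)) T)`.
segmentCell : ℕ → ℕ → ℕ → Maybe (Maybe ℕ)
segmentCell i j x = if x <ᵇ i then just nothing else (if j <ᵇ x then nothing else just (just (x ∸ (i ∸ 1))))

module _ {i : ℕ} where

  segmentCell-below : ∀ {x} → x < i → segmentCell i (suc i) x ≡ just nothing
  segmentCell-below x<i rewrite <⇒<ᵇ≡true x<i = refl

  segmentCell-first : 1 ≤ i → segmentCell i (suc i) i ≡ just (just 1)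
  segmentCell-first (s≤s {n = m} _)
    rewrite ≤⇒<ᵇ≡false (≤-refl {suc m}) | ≤⇒<ᵇ≡false (n≤1+n (suc m)) =
      cong (λ x → just (just x)) (m+n∸n≡m 1 m)

  segmentCell-second : 1 ≤ i → segmentCell i (suc i) (suc i) ≡ just (just 2)
  segmentCell-second (s≤s {n = m} _)
    rewrite ≤⇒<ᵇ≡false (n≤1+n (suc m)) | ≤⇒<ᵇ≡false (≤-refl {suc (suc m)}) =
      cong (λ x → just (just x)) (m+n∸n≡m 2 m)

  segmentCell-above : ∀ {x} → suc i < x → segmentCell i (suc i) x ≡ nothing
  segmentCell-above {x} i+1<x
    rewrite ≤⇒<ᵇ≡false {x} {i} (<⇒≤ (<-trans (n<1+n i) i+1<x)) | <⇒<ᵇ≡true i+1<x = refl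

  segmentCell-vacant : ∀ {x} → segmentCell i (suc i) x ≡ nothing → suc i < x
  segmentCell-vacant {x} eq with x <ᵇ i | suc i <ᵇ x in i+1<ᵇx
  ... | false | true = <ᵇ⇒< (suc i) x (subst T (sym i+1<ᵇx) _)

  segmentCell-upward : ∀ {x y} → x < y →
                       segmentCell i (suc i) x ≡ nothing → segmentCell i (suc i) y ≡ nothing
  segmentCell-upward x<y = segmentCell-above ∘ flip <-trans x<y ∘ segmentCell-vacant

descentᵇ : Tab → ℕ → Bool
descentᵇ T i = proj₁ (cellOf i T) <ᵇ proj₁ (cellOf (suc i) T)

module StandardTableau {n : ℕ} {Q : Tab} (syt : IsSYT n Q) where
  open IsSYT syt

  entries-unique : Unique (concat Q)
  entries-unique = Unique-resp-↭ (↭⇒↭ₛ (↭-sym content)) (Unique.map⁺ suc-injective (Unique.upTo⁺ n))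

  cellOf-entry : ∀ {p x} → entry Q p ≡ just x → cellOf x Q ≡ p
  cellOf-entry = cellOf-unique Q entries-unique

  entry-positive : ∀ {p x} → entry Q p ≡ just x → 1 ≤ x
  entry-positive = proj₁ ∘ range-∈ ∘ ∈-resp-↭ content ∘ entry-∈ Q

  entry-cellOf : ∀ {x} → 1 ≤ x → x ≤ n → entry Q (cellOf x Q) ≡ just x
  entry-cellOf 1≤x x≤n with p , eq ← ∈-entry Q (∈-resp-↭ (↭-sym content) (∈-range 1≤x x≤n))
    rewrite cellOf-entry eq = eq

  entry-increasing : ∀ {q p y} → q ◁ p → entry Q p ≡ just y → ∃[ x ] entry Q q ≡ just x × x < y
  entry-increasing left  eq = rows-increasing Q rowsIncrease eq
  entry-increasing {r , c} above eq
    with x , eq′ , x<y ← colsIncrease r c _ (trans (cell≡entry Q (suc r) c) eq)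
    = x , trans (sym (cell≡entry Q r c)) eq′ , x<y

  below : ℕ → Pos → Bool
  below k p = maybe′ (_<ᵇ k) false (entry Q p)

  below-closed : ∀ k → Closed (below k)
  below-closed k {q} {p} q◁p p∈ with entry Q p in eq
  ... | just y with x , eq′ , x<y ← entry-increasing q◁p eq rewrite eq′ =
    <⇒<ᵇ (<-trans x<y (<ᵇ⇒< y k p∈))

  below-one : below 1 ≗ ∅
  below-one p with entry Q p in eq
  ... | nothing = refl
  ... | just x  = ≤⇒<ᵇ≡false (entry-positive eq)

  below-suc : ∀ {k} → 1 ≤ k → k ≤ n → below (suc k) ≗ (below k ∪｛ cellOf k Q ｝)
  below-suc {k} 1≤k k≤n p with p ≟ₚ cellOf k Q
  ... | yes refl rewrite entry-cellOf 1≤k k≤n = <⇒<ᵇ≡true (n<1+n k)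
  ... | no p≢z with entry Q p in eq
  ...   | nothing = refl
  ...   | just x  = sym (<ᵇ-sucʳ {x} {k} λ { refl → p≢z (sym (cellOf-entry eq)) })

  cellOf-corner : ∀ {k} → 1 ≤ k → k ≤ n → OuterCorner (below k) (cellOf k Q)
  cellOf-corner {k} 1≤k k≤n = record { outside = outside ; supported = supported }
    where
    outside : ¬ T (below k (cellOf k Q))
    outside rewrite entry-cellOf 1≤k k≤n = n≮n k ∘ <ᵇ⇒< k k
    supported : ∀ {q} → q ◁ cellOf k Q → T (below k q)
    supported q◁ with x , eq , x<k ← entry-increasing q◁ (entry-cellOf 1≤k k≤n) rewrite eq = <⇒<ᵇ x<k

  below-entry : ∀ {k p x} → entry Q p ≡ just x → below k p ≡ (x <ᵇ k)
  below-entry {k} eq = cong (maybe′ (_<ᵇ k) false) eq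

  ≢-cellOf : ∀ {p y} → 1 ≤ y → y ≤ n → entry Q p ≢ just y → p ≢ cellOf y Q
  ≢-cellOf 1≤y y≤n ne refl = ne (entry-cellOf 1≤y y≤n)

  module Segment {i : ℕ} (1≤i : 1 ≤ i) (i<n : suc i ≤ n) where
    private
      A B : Pos
      A = cellOf i Q
      B = cellOf (suc i) Q
      i≤n : i ≤ n
      i≤n = <⇒≤ i<n
      ≢A : ∀ {p} → entry Q p ≢ just i → p ≢ A
      ≢A = ≢-cellOf 1≤i i≤n
      ≢B : ∀ {p} → entry Q p ≢ just (suc i) → p ≢ B
      ≢B = ≢-cellOf (s≤s z≤n) i<n
      A≢B : A ≢ B
      A≢B = ≢B (≡just⇒≢just (entry-cellOf 1≤i i≤n) (1+n≢n ∘ sym))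

    A-corner : OuterCorner (below i) A
    A-corner = cellOf-corner 1≤i i≤n

    B-corner : OuterCorner (below i ∪｛ A ｝) B
    B-corner = OuterCorner-≗ (below-suc 1≤i i≤n) (cellOf-corner (s≤s z≤n) i<n)

    segment-cells : ∀ p → (entry Q p >>= segmentCell i (suc i)) ≡ layout (below i) A B p
    segment-cells p = cells (entry Q p) refl
      where
      vacant : ¬ T (below i p) → p ≢ A → p ≢ B → layout (below i) A B p ≡ nothing
      vacant p∉ p≢A p≢B = layout-vacant (below i) A B p (∉-occupied (below i) A B p≢A p≢B p∉)
      cells : ∀ m → entry Q p ≡ m → (m >>= segmentCell i (suc i)) ≡ layout (below i) A B p
      cells nothing eq = sym (vacant (subst T (cong (maybe′ (_<ᵇ i) false) eq))
                                     (≢A (≡nothing⇒≢just eq)) (≢B (≡nothing⇒≢just eq)))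
      cells (just x) eq with <-cmp x i
      ... | tri< x<i _ _ = trans (segmentCell-below x<i) (sym (layout-hole (below i) A B
                             (≢A (≡just⇒≢just eq (<⇒≢ x<i)))
                             (≢B (≡just⇒≢just eq (<⇒≢ (m<n⇒m<1+n x<i))))
                             (subst T (sym (below-entry {i} eq)) (<⇒<ᵇ x<i))))
      ... | tri≈ _ refl _ with refl ← cellOf-entry eq =
        trans (segmentCell-first 1≤i) (sym (layout-one (below i) A B))
      ... | tri> _ _ i<x with m≤n⇒m<n∨m≡n i<x
      ...   | inj₂ refl with refl ← cellOf-entry eq =
        trans (segmentCell-second 1≤i) (sym (layout-two (below i) A B A≢B))
      ...   | inj₁ i+1<x = trans (segmentCell-above i+1<x) (sym (vacant
                             (<-asym i<x ∘ <ᵇ⇒< x i ∘ subst T (below-entry {i} eq))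
                             (≢A (≡just⇒≢just eq (>⇒≢ i<x))) (≢B (≡just⇒≢just eq (>⇒≢ i+1<x)))))

    segment-TwoCellSkew : TwoCellSkew (below i) (descentᵇ Q i) (segment i (suc i) Q)
    segment-TwoCellSkew = record
      { one        = A
      ; two        = B
      ; represents = Represents-dropEmptyRows (map (mapMaybe (segmentCell i (suc i))) Q)
                       (Closed-occupied (below-closed i) A-corner B-corner)
                       (λ p → trans (entry-map-mapMaybe (segmentCell-upward {i}) rowsIncrease p) (segment-cells p))
      ; one-corner = A-corner
      ; two-corner = B-corner
      ; rows       = refl
      }

  slideAll : ℕ → List ℕ → STab → STab
  slideAll fuel ks t = foldl (λ t k → slideAt fuel (cellOf k Q) t) t ks

  slideAll-TwoCellSkew : ∀ f m {d t} → m < n → TwoCellSkew (below (suc m)) d t →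
                         TwoCellSkew (below 1) d (slideAll (3 + f) (map suc (downFrom m)) t)
  slideAll-TwoCellSkew f zero    _   s = s
  slideAll-TwoCellSkew f (suc m) m<n s =
    slideAll-TwoCellSkew f m (<-trans (n<1+n m) m<n)
      (slide-TwoCellSkew (below-closed (suc m)) (cellOf-corner (s≤s z≤n) (<⇒≤ m<n)) f
        (TwoCellSkew-≗ (below-suc (s≤s z≤n) (<⇒≤ m<n)) s))

  length-entries : length (concat Q) ≡ n
  length-entries = trans (↭-length content) (trans (length-map suc (upTo n)) (length-upTo n))

  fuel≡ : 1 ≤ n → 2 * length (concat Q) + 1 ≡ 3 + 2 * (n ∸ 1)
  fuel≡ 1≤n = begin
    2 * length (concat Q) + 1  ≡⟨ cong (λ l → 2 * l + 1) (trans length-entries (sym (m+[n∸m]≡n 1≤n))) ⟩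
    2 * suc (n ∸ 1) + 1        ≡⟨ cong (_+ 1) (*-suc 2 (n ∸ 1)) ⟩
    2 + 2 * (n ∸ 1) + 1        ≡⟨ cong (2 +_) (+-comm (2 * (n ∸ 1)) 1) ⟩
    3 + 2 * (n ∸ 1)            ∎
    where open ≡-Reasoning

  st-consecutive : ∀ {i} → 1 ≤ i → suc i ≤ n →
                   st Q i (suc i) ≡ (if descentᵇ Q i then column₁₂ else row₁₂)
  st-consecutive {suc m} 1≤i i<n = begin
      st Q (suc m) (suc (suc m))
    ≡⟨ cong₂ (λ fuel ks → dropEmptyRows (map catMaybes (slideAll fuel ks segmentᵢ)))
             (fuel≡ (≤-trans 1≤i (<⇒≤ i<n))) order≡ ⟩
      dropEmptyRows (map catMaybes (slideAll (3 + 2 * (n ∸ 1)) (map suc (downFrom m)) segmentᵢ))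
    ≡⟨ rectified-shape (TwoCellSkew-≗ below-one
         (slideAll-TwoCellSkew (2 * (n ∸ 1)) m (<-trans (n<1+n m) i<n) (Segment.segment-TwoCellSkew 1≤i i<n))) ⟩
      (if descentᵇ Q (suc m) then column₁₂ else row₁₂)
    ∎
    where
    open ≡-Reasoning
    segmentᵢ : STab
    segmentᵢ = segment (suc m) (suc (suc m)) Q
    order≡ : reverse (range m) ≡ map suc (downFrom m)
    order≡ = trans (sym (reverse-map suc (upTo m))) (cong (map suc) (reverse-upTo m))

  Des⇒descentᵇ : ∀ {i} → Des n Q i → descentᵇ Q i ≡ true
  Des⇒descentᵇ (_ , _ , r , r′ , r<r′ , i∈r , i+1∈r′)
    with c , eq ← InRow⇒entry Q i∈r | c′ , eq′ ← InRow⇒entry Q i+1∈r′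
    rewrite cellOf-entry eq | cellOf-entry eq′ = <⇒<ᵇ≡true r<r′

  descentᵇ⇒Des : ∀ {i} → 1 ≤ i → i < n → descentᵇ Q i ≡ true → Des n Q i
  descentᵇ⇒Des 1≤i i<n descent =
    1≤i , i<n , _ , _ , <ᵇ⇒< _ _ (subst T (sym descent) _) ,
    entry⇒InRow Q (entry-cellOf 1≤i (<⇒≤ i<n)) , entry⇒InRow Q (entry-cellOf (s≤s z≤n) i<n)

-- Descents and the weak order

row₁₂-syt : IsSYT 2 row₁₂
row₁₂-syt = record
  { rowsNonempty   = s≤s z≤n ∷ []
  ; shapePartition = [-]
  ; rowsIncrease   = (s≤s (s≤s z≤n) ∷ [-]) ∷ []
  ; colsIncrease   = λ { r c b () }
  ; content        = ↭-refl
  }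

column₁₂-syt : IsSYT 2 column₁₂
column₁₂-syt = record
  { rowsNonempty   = s≤s z≤n ∷ s≤s z≤n ∷ []
  ; shapePartition = ≤-refl ∷ [-]
  ; rowsIncrease   = [-] ∷ [-] ∷ []
  ; colsIncrease   = λ { zero    zero    .2 refl → 1 , refl , s≤s (s≤s z≤n)
                       ; zero    (suc c) b  ()
                       ; (suc r) c       b  () }
  ; content        = ↭-refl
  }

identity-no-inversion : ∀ {i j} → InvL (1 ∷ 2 ∷ []) i j → ⊥
identity-no-inversion (s≤s () , [] , [] , _ , refl)
identity-no-inversion (_ , [] , _ ∷ [] , _ , ())
identity-no-inversion (_ , [] , _ ∷ _ ∷ _ , _ , ())
identity-no-inversion (_ , _ ∷ [] , [] , _ , ())
identity-no-inversion (_ , _ ∷ [] , _ ∷ _ , _ , ())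
identity-no-inversion (_ , _ ∷ _ ∷ [] , _ , _ , ())
identity-no-inversion (_ , _ ∷ _ ∷ _ ∷ _ , _ , _ , ())

row₁₂≤column₁₂ : row₁₂ ≤weak[ 2 ] column₁₂
row₁₂≤column₁₂ = [ (1 ∷ 2 ∷ []) , (2 ∷ 1 ∷ []) , ↭-refl , ↭-swap 2 1 ↭-refl , refl , refl ,
                   (λ i j inv → ⊥-elim (identity-no-inversion inv)) ]

lemma3p2 : (R : ℕ → Tab → Tab → Set) →
    IsSYTPosetFamily R →
    -- (a) stronger than the weak order
    (∀ N S T → 1 ≤ N → IsSYT N S → IsSYT N T → S ≤weak[ N ] T → R N S T) →
    -- (b) restricts to segments
    (∀ N S T → 1 ≤ N → IsSYT N S → IsSYT N T → R N S T →
      ∀ i j → 1 ≤ i → i < j → j ≤ N →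
      R (j ∸ i + 1) (st S i j) (st T i j)) →
    ∀ n → 2 ≤ n → ∀ S T → IsSYT n S → IsSYT n T → R n S T →
    ∀ i → Des n S i → Des n T i
lemma3p2 R poset weak⇒R restricts n 2≤n S T S-syt T-syt S≤T i S-descent@(1≤i , i<n , _) =
  StandardTableau.descentᵇ⇒Des T-syt 1≤i i<n (column-forced (descentᵇ T i) pairs-related)
  where
  open IsSYTPosetFamily poset using (antisym)
  segments-related : R 2 (st S i (suc i)) (st T i (suc i))
  segments-related = subst (λ N → R N (st S i (suc i)) (st T i (suc i))) (cong (_+ 1) (m+n∸n≡m 1 i))
    (restricts n S T (≤-trans (s≤s z≤n) 2≤n) S-syt T-syt S≤T i (suc i) 1≤i (n<1+n i) i<n)
  pairs-related : R 2 column₁₂ (if descentᵇ T i then column₁₂ else row₁₂)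
  pairs-related = subst₂ (R 2)
    (trans (StandardTableau.st-consecutive S-syt 1≤i i<n)
           (cong (λ b → if b then column₁₂ else row₁₂) (StandardTableau.Des⇒descentᵇ S-syt S-descent)))
    (StandardTableau.st-consecutive T-syt 1≤i i<n)
    segments-related
  column-forced : ∀ b → R 2 column₁₂ (if b then column₁₂ else row₁₂) → b ≡ true
  column-forced true  _ = refl
  column-forced false column≤row
    with () ← antisym 2 column₁₂ row₁₂ (s≤s z≤n) column₁₂-syt row₁₂-syt column≤row
                (weak⇒R 2 row₁₂ column₁₂ (s≤s z≤n) row₁₂-syt column₁₂-syt row₁₂≤column₁₂)
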